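{- If $b$ is a sequence of $n$ distinct integers that is a tableau word, then $T^\ast(b)$ is a tableau word of the same shape.
   Context: Standard BBS: boxes indexed by $\mathbf{Z}$ with capacity one, $n$ balls of distinct colors $1,\dots,n$, at most one ball per box. One time step: move the ball of color $1$ to the nearest empty box to its right, then the ball of color $2$, and so on up to color $n$, each ball moved exactly once. A sequence $b=(b_1,\dots,b_n)$ of distinct integers is identified with the state in which the ball of color $k$ is in box $b_k$; $T^\ast(b)$ denotes the box-label sequence of the state obtained by one time step. A (semistandard) tableau is a filling of a Young diagram with integers weakly increasing along rows and strictly increasing down columns. The word $W(T)$ of a tableau $T$ is obtained by reading its rows from left to right, starting with the bottom row and proceeding upward to the top row. A tableau word of shape $\lambda$ is a word of the form $W(T)$ for a tableau $T$ of shape $\lambda$. -}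

module Defs where

open import Data.Integer using (ℤ; _<_; _≤_; _+_; 1ℤ)
open import Data.Integer.Properties using (_≟_)
open import Data.Nat using (ℕ; zero; suc)
open import Data.List using (List; []; _∷_; _++_; [_]; length; map; concat; reverse)
open import Data.List.Membership.DecPropositional _≟_ using (_∈?_)
open import Data.List.Relation.Unary.Linked using (Linked)
open import Data.List.Relation.Unary.All using (All)
open import Data.List.Relation.Unary.Unique.Propositional using (Unique)
open import Data.Product using (Σ; _×_)
open import Relation.Binary.PropositionalEquality using (_≡_)
open import Relation.Nullary using (yes; no)

-- nearestEmpty fuel occ x : the smallest box y > x with y ∉ occ,
-- searched with a fuel bound (fuel = length occ + 1 always suffices,
-- since at most length occ boxes are occupied).
nearestEmpty : ℕ → List ℤ → ℤ → ℤ
nearestEmpty zero    occ x = x + 1ℤ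
nearestEmpty (suc f) occ x with (x + 1ℤ) ∈? occ
... | yes _ = nearestEmpty f occ (x + 1ℤ)
... | no  _ = x + 1ℤ

-- moveFrom done rest : balls in `done` have already been moved (colours
-- 1..k), balls in `rest` not yet; move the first ball of `rest` to the
-- nearest empty box to its right (occupied boxes: done ++ rest), then continue.
moveFrom : List ℤ → List ℤ → List ℤ
moveFrom done []         = done
moveFrom done (x ∷ rest) =
  moveFrom (done ++ [ nearestEmpty (suc (length (done ++ x ∷ rest))) (done ++ x ∷ rest) x ]) rest

-- One time step T* of the BBS, b = (b₁,…,bₙ) with ball of colour k in box b_k.
T* : List ℤ → List ℤ
T* b = moveFrom [] b

IsPartition : List ℕ → Set
IsPartition λ′ = Linked Data.Nat._≥_ λ′ × All (λ k → 0 Data.Nat.< k) λ′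
  where import Data.Nat

data Below : List ℤ → List ℤ → Set where
  []  : ∀ {us} → Below us []
  _∷_ : ∀ {u us l ls} → u < l → Below us ls → Below (u ∷ us) (l ∷ ls)

ColumnsStrict : List (List ℤ) → Set
ColumnsStrict rows = Linked Below rows

-- a semistandard tableau, given as its list of rows from top to bottom
IsTableau : List (List ℤ) → Set
IsTableau rows = All (Linked _≤_) rows × ColumnsStrict rows

shape : List (List ℤ) → List ℕ
shape rows = map length rows

word : List (List ℤ) → List ℤ
word rows = concat (reverse rows)

IsTableauWord : List ℕ → List ℤ → Set
IsTableauWord λ′ w =
  Σ (List (List ℤ)) (λ T → IsTableau T × shape T ≡ λ′ × word T ≡ w)

{-# OPTIONS --safe #-}
-- Move the balls in reading order, i.e. bottom row first. A ball at x lands in the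
-- first empty box y > x; every box strictly between x and y is occupied.
-- Rows: if x < x′ are neighbours in a row, the target y′ of x′ is an empty box
-- beyond x other than the now occupied y, so minimality of y gives y < y′.
-- Columns: when the ball u above l moves, the ball from l has already left for
-- some l′ > l, and nothing else can have entered box l, so u lands at most at l < l′.
-- The fuel of nearestEmpty suffices by pigeonhole: a failed search would exhibit
-- more occupied boxes than there are balls.
module Submission where

open import Defs
open import Data.Nat using (ℕ)
open import Data.Integer using (ℤ)
open import Data.List using (List)
open import Data.List.Relation.Unary.Unique.Propositional using (Unique)

open import Data.Nat as ℕ using (zero; suc; z≤n; s≤s)
import Data.Nat.Properties as ℕ
open import Data.Integer using (_+_; 1ℤ; _<_; _≤_; _≮_)
open import Data.Integer.Properties
  using (_≟_; suc[i]≤j⇒i<j; i<j⇒suc[i]≤j; ≤-reflexive; +-comm; <-irrefl; <-trans;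
         ≤-<-trans; <⇒≤; <⇒≢; ≤∧≢⇒<; ≮⇒≥)
open import Data.List using ([]; _∷_; _++_; [_]; length; filter; concat; reverse)
open import Data.List.Properties using (++-assoc; ++-identityʳ; filter-notAll; unfold-reverse; concat-++)
open import Data.List.Membership.Propositional using (_∈_; _∉_)
open import Data.List.Membership.Propositional.Properties using (∈-++⁺ˡ; ∈-++⁺ʳ; ∈-++⁻; ∈-filter⁺)
open import Data.List.Membership.DecPropositional _≟_ using (_∈?_)
open import Data.List.Relation.Binary.Subset.Propositional using (_⊆_)
open import Data.List.Relation.Binary.Disjoint.Propositional using (Disjoint)
open import Data.List.Relation.Binary.Pointwise using (Pointwise; []; _∷_; All-resp-Pointwise)
open import Data.List.Relation.Unary.Any as Any using (here; there)
open import Data.List.Relation.Unary.All as All using (All; []; _∷_)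
open import Data.List.Relation.Unary.All.Properties using (¬Any⇒All¬; ++⁻ˡ; ++⁻ʳ)
open import Data.List.Relation.Unary.AllPairs using ([]; _∷_)
open import Data.List.Relation.Unary.Linked as Linked using (Linked; []; [-]; _∷_)
open import Data.List.Relation.Unary.Linked.Properties using (Linked⇒All)
open import Data.Product using (_×_; _,_; proj₁; proj₂)
open import Data.Sum as Sum using (_⊎_; inj₁; inj₂)
open import Data.Empty using (⊥-elim)
open import Function using (_∘_)
open import Relation.Binary.Definitions using (DecidableEquality)
open import Relation.Binary.PropositionalEquality
  using (_≡_; _≢_; refl; sym; trans; cong; cong₂; subst; module ≡-Reasoning)
open import Relation.Nullary using (yes; no; ¬?)

open ≡-Reasoning

i<i+1 : ∀ i → i < i + 1ℤ
i<i+1 i = suc[i]≤j⇒i<j (≤-reflexive (+-comm 1ℤ i))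

i<j⇒i+1≤j : ∀ {i j} → i < j → i + 1ℤ ≤ j
i<j⇒i+1≤j {i} {j} i<j = subst (_≤ j) (+-comm 1ℤ i) (i<j⇒suc[i]≤j i<j)

i<j⇒j≮i+1 : ∀ {i j} → i < j → j ≮ i + 1ℤ
i<j⇒j≮i+1 i<j j<i+1 = <-irrefl refl (≤-<-trans (i<j⇒i+1≤j i<j) j<i+1)

unique⊆⇒length≤ : ∀ {a} {A : Set a} → DecidableEquality A →
                  ∀ {xs ys : List A} → Unique xs → xs ⊆ ys → length xs ℕ.≤ length ys
unique⊆⇒length≤ _≟_ {[]}     _          _     = z≤n
unique⊆⇒length≤ _≟_ {x ∷ xs} {ys} (x∉xs ∷ u) xs⊆ys =
  ℕ.≤-trans (s≤s (unique⊆⇒length≤ _≟_ u xs⊆ys-x))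
            (filter-notAll x≢? ys (Any.map (λ x≡z x≢z → x≢z x≡z) (xs⊆ys (here refl))))
  where
  x≢? = λ z → ¬? (x ≟ z)
  xs⊆ys-x : xs ⊆ filter x≢? ys
  xs⊆ys-x z∈xs = ∈-filter⁺ x≢? (xs⊆ys (there z∈xs)) (All.lookup x∉xs z∈xs)

Unique-++⁻ : ∀ {a} {A : Set a} (xs : List A) {ys} →
             Unique (xs ++ ys) → Unique xs × Unique ys × Disjoint xs ys
Unique-++⁻ []       u = [] , u , λ { (() , _) }
Unique-++⁻ (x ∷ xs) (x∉ ∷ u) =
  let uxs , uys , xs#ys = Unique-++⁻ xs u in
  ++⁻ˡ xs x∉ ∷ uxs , uys , λ where
    (here refl  , v∈ys) → All.lookup (++⁻ʳ xs x∉) v∈ys refl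
    (there v∈xs , v∈ys) → xs#ys (v∈xs , v∈ys)

linked⇒All : ∀ {x xs} → Linked _<_ (x ∷ xs) → All (x <_) xs
linked⇒All [-]        = []
linked⇒All (x<y ∷ lk) = Linked⇒All <-trans x<y lk

linked-≤⇒< : ∀ {xs} → Unique xs → Linked _≤_ xs → Linked _<_ xs
linked-≤⇒< _                []         = []
linked-≤⇒< _                [-]        = [-]
linked-≤⇒< ((x≢y ∷ _) ∷ u) (x≤y ∷ lk) = ≤∧≢⇒< x≤y x≢y ∷ linked-≤⇒< u lk

<-nearestEmpty : ∀ f occ x → x < nearestEmpty f occ x
<-nearestEmpty zero    occ x = i<i+1 x
<-nearestEmpty (suc f) occ x with (x + 1ℤ) ∈? occ
... | yes _ = <-trans (i<i+1 x) (<-nearestEmpty f occ (x + 1ℤ))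
... | no  _ = i<i+1 x

nearestEmpty-minimal : ∀ f occ x {z} → x < z → z < nearestEmpty f occ x → z ∈ occ
nearestEmpty-minimal zero    occ x x<z z<e = ⊥-elim (i<j⇒j≮i+1 x<z z<e)
nearestEmpty-minimal (suc f) occ x {z} x<z z<e with (x + 1ℤ) ∈? occ
... | no  _ = ⊥-elim (i<j⇒j≮i+1 x<z z<e)
... | yes x+1∈occ with (x + 1ℤ) ≟ z
...   | yes refl = x+1∈occ
...   | no  x+1≢z = nearestEmpty-minimal f occ (x + 1ℤ) (≤∧≢⇒< (i<j⇒i+1≤j x<z) x+1≢z) z<e

searched : ℕ → ℤ → List ℤ
searched zero    x = [ x + 1ℤ ]
searched (suc f) x = x + 1ℤ ∷ searched f (x + 1ℤ)

length-searched : ∀ f x → length (searched f x) ≡ suc f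
length-searched zero    x = refl
length-searched (suc f) x = cong suc (length-searched f (x + 1ℤ))

searched-above : ∀ f x → All (x <_) (searched f x)
searched-above zero    x = i<i+1 x ∷ []
searched-above (suc f) x = i<i+1 x ∷ All.map (<-trans (i<i+1 x)) (searched-above f (x + 1ℤ))

unique-searched : ∀ f x → Unique (searched f x)
unique-searched zero    x = [] ∷ []
unique-searched (suc f) x = All.map <⇒≢ (searched-above f (x + 1ℤ)) ∷ unique-searched f (x + 1ℤ)

nearestEmpty-∈⇒searched⊆ : ∀ f occ x → nearestEmpty f occ x ∈ occ → searched f x ⊆ occ
nearestEmpty-∈⇒searched⊆ zero    occ x x+1∈occ (here refl) = x+1∈occ
nearestEmpty-∈⇒searched⊆ (suc f) occ x e∈occ z∈ with (x + 1ℤ) ∈? occ | z∈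
... | no  x+1∉occ | _         = ⊥-elim (x+1∉occ e∈occ)
... | yes x+1∈occ | here refl = x+1∈occ
... | yes _       | there z∈′ = nearestEmpty-∈⇒searched⊆ f occ (x + 1ℤ) e∈occ z∈′

nextEmpty : List ℤ → ℤ → ℤ
nextEmpty occ x = nearestEmpty (suc (length occ)) occ x

<-nextEmpty : ∀ occ x → x < nextEmpty occ x
<-nextEmpty occ x = <-nearestEmpty (suc (length occ)) occ x

nextEmpty-∉ : ∀ occ x → nextEmpty occ x ∉ occ
nextEmpty-∉ occ x e∈occ = ℕ.<-irrefl refl (ℕ.<-trans (ℕ.n<1+n (length occ)) too-long)
  where
  fuel = suc (length occ)
  too-long : suc fuel ℕ.≤ length occ
  too-long = subst (ℕ._≤ length occ) (length-searched fuel x)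
    (unique⊆⇒length≤ _≟_ (unique-searched fuel x) (nearestEmpty-∈⇒searched⊆ fuel occ x e∈occ))

nextEmpty-≤ : ∀ occ x {h} → x < h → h ∉ occ → nextEmpty occ x ≤ h
nextEmpty-≤ occ x x<h h∉occ =
  ≮⇒≥ (λ h<e → h∉occ (nearestEmpty-minimal (suc (length occ)) occ x x<h h<e))

∈-replace⁺ : ∀ {a} {A : Set a} (d : List A) {x y z r} →
             z ∈ d ++ x ∷ r → z ≢ x → z ∈ (d ++ [ y ]) ++ r
∈-replace⁺ []      (here z≡x)  z≢x = ⊥-elim (z≢x z≡x)
∈-replace⁺ []      (there z∈r) _   = there z∈r
∈-replace⁺ (a ∷ d) (here z≡a)  _   = here z≡a
∈-replace⁺ (a ∷ d) (there z∈)  z≢x = there (∈-replace⁺ d z∈ z≢x)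

∈-replace⁻ : ∀ {a} {A : Set a} (d : List A) {x y z r} →
             z ∈ (d ++ [ y ]) ++ r → z ≡ y ⊎ z ∈ d ++ x ∷ r
∈-replace⁻ []      (here z≡y)  = inj₁ z≡y
∈-replace⁻ []      (there z∈r) = inj₂ (there z∈r)
∈-replace⁻ (a ∷ d) (here z≡a)  = inj₂ (here z≡a)
∈-replace⁻ (a ∷ d) (there z∈)  = Sum.map₂ there (∈-replace⁻ d z∈)

Unique-replace : ∀ {a} {A : Set a} (d : List A) {x y r} →
                 Unique (d ++ x ∷ r) → y ∉ d ++ x ∷ r → Unique ((d ++ [ y ]) ++ r)
Unique-replace []      {r = r} (_ ∷ u) y∉ = ¬Any⇒All¬ r (y∉ ∘ there) ∷ u
Unique-replace (a ∷ d) {x} {y} {r} (a∉ ∷ u) y∉ =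
  All.tabulate a≢ ∷ Unique-replace d u (y∉ ∘ there)
  where
  a≢ : ∀ {z} → z ∈ (d ++ [ y ]) ++ r → a ≢ z
  a≢ z∈ with ∈-replace⁻ d {x} z∈
  ... | inj₁ refl  = λ a≡y → y∉ (here (sym a≡y))
  ... | inj₂ z∈old = All.lookup a∉ z∈old

-- moveBlock d xs ys: the boxes the balls xs move to, when the balls before them
-- have already moved to the boxes d and the balls ys move after them.
moveBlock : List ℤ → List ℤ → List ℤ → List ℤ
moveBlock d []       ys = []
moveBlock d (x ∷ xs) ys = y ∷ moveBlock (d ++ [ y ]) xs ys
  where y = nextEmpty (d ++ x ∷ xs ++ ys) x

moveFrom-++ : ∀ d xs ys → moveFrom d (xs ++ ys) ≡ moveFrom (d ++ moveBlock d xs ys) ys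
moveFrom-++ d []       ys = cong (λ d′ → moveFrom d′ ys) (sym (++-identityʳ d))
moveFrom-++ d (x ∷ xs) ys = begin
  moveFrom (d ++ [ y ]) (xs ++ ys)
    ≡⟨ moveFrom-++ (d ++ [ y ]) xs ys ⟩
  moveFrom ((d ++ [ y ]) ++ moveBlock (d ++ [ y ]) xs ys) ys
    ≡⟨ cong (λ d′ → moveFrom d′ ys) (++-assoc d [ y ] _) ⟩
  moveFrom (d ++ moveBlock d (x ∷ xs) ys) ys
    ∎
  where y = nextEmpty (d ++ x ∷ xs ++ ys) x

length-moveBlock : ∀ d xs ys → length (moveBlock d xs ys) ≡ length xs
length-moveBlock d []       ys = refl
length-moveBlock d (x ∷ xs) ys = cong suc (length-moveBlock _ xs ys)

<-moveBlock : ∀ d xs ys → Pointwise _<_ xs (moveBlock d xs ys)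
<-moveBlock d []       ys = []
<-moveBlock d (x ∷ xs) ys = <-nextEmpty (d ++ x ∷ xs ++ ys) x ∷ <-moveBlock _ xs ys

Unique-moveBlock : ∀ d xs ys → Unique (d ++ xs ++ ys) → Unique (d ++ moveBlock d xs ys ++ ys)
Unique-moveBlock d []       ys u = u
Unique-moveBlock d (x ∷ xs) ys u =
  subst Unique (++-assoc d [ y ] _)
    (Unique-moveBlock (d ++ [ y ]) xs ys (Unique-replace d u (nextEmpty-∉ _ x)))
  where y = nextEmpty (d ++ x ∷ xs ++ ys) x

nextEmpty-successive : ∀ d {x x′} r → x < x′ →
  nextEmpty (d ++ x ∷ r) x < nextEmpty ((d ++ [ nextEmpty (d ++ x ∷ r) x ]) ++ r) x′
nextEmpty-successive d {x} {x′} r x<x′ = ≤∧≢⇒< y≤y′ y≢y′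
  where
  occ  = d ++ x ∷ r
  y    = nextEmpty occ x
  occ′ = (d ++ [ y ]) ++ r
  y′   = nextEmpty occ′ x′
  x<y′ : x < y′
  x<y′ = <-trans x<x′ (<-nextEmpty occ′ x′)
  y≤y′ : y ≤ y′
  y≤y′ = nextEmpty-≤ occ x x<y′
    (λ y′∈occ → nextEmpty-∉ occ′ x′ (∈-replace⁺ d y′∈occ (<⇒≢ x<y′ ∘ sym)))
  y≢y′ : y ≢ y′
  y≢y′ y≡y′ = nextEmpty-∉ occ′ x′ (subst (_∈ occ′) y≡y′ (∈-++⁺ˡ (∈-++⁺ʳ d (here refl))))

moveBlock-strict : ∀ d {xs} ys → Linked _<_ xs → Linked _<_ (moveBlock d xs ys)
moveBlock-strict d ys []  = []
moveBlock-strict d ys [-] = [-]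
moveBlock-strict d {x ∷ x′ ∷ xs} ys (x<x′ ∷ lk) =
  nextEmpty-successive d (x′ ∷ xs ++ ys) x<x′ ∷ moveBlock-strict (d ++ [ _ ]) ys lk

moveBlock-vacates : ∀ d {xs} ys → Linked _<_ xs → All (_∉ moveBlock d xs ys) xs
moveBlock-vacates d ys [] = []
moveBlock-vacates d {x ∷ xs} ys lk =
  x∉ ∷ All.zipWith (λ (z≢y , z∉) → λ { (here z≡y) → z≢y z≡y ; (there z∈) → z∉ z∈ })
                   (All.tabulate z≢y , moveBlock-vacates (d ++ [ y ]) ys (Linked.tail lk))
  where
  occ = d ++ x ∷ xs ++ ys
  y   = nextEmpty occ x
  x∉ : x ∉ moveBlock d (x ∷ xs) ys
  x∉ (here x≡y) = <-irrefl x≡y (<-nextEmpty occ x)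
  x∉ (there x∈) = <-irrefl refl (All.lookup x<moved x∈)
    where
    x<moved : All (x <_) (moveBlock (d ++ [ y ]) xs ys)
    x<moved = All-resp-Pointwise (λ z<z′ x<z → <-trans x<z z<z′)
                (<-moveBlock (d ++ [ y ]) xs ys) (linked⇒All lk)
  z≢y : ∀ {z} → z ∈ xs → z ≢ y
  z≢y z∈xs z≡y = nextEmpty-∉ occ x (subst (_∈ occ) z≡y (∈-++⁺ʳ d (there (∈-++⁺ˡ z∈xs))))

moveBlock-below-vacated : ∀ d {r ls ls′} ys → Below r ls → Linked _<_ ls →
                          Pointwise _<_ ls ls′ → All (_∉ d ++ r ++ ys) ls →
                          Below (moveBlock d r ys) ls′
moveBlock-below-vacated d ys [] _ [] _ = []
moveBlock-below-vacated d {u ∷ us} {l ∷ ls} ys (u<l ∷ below) lk (l<l′ ∷ pw) (l∉ ∷ ls∉) =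
  ≤-<-trans y≤l l<l′ ∷ moveBlock-below-vacated (d ++ [ y ]) ys below (Linked.tail lk) pw ls∉′
  where
  y = nextEmpty (d ++ u ∷ us ++ ys) u
  y≤l : y ≤ l
  y≤l = nextEmpty-≤ _ u u<l l∉
  ls∉′ : All (_∉ (d ++ [ y ]) ++ us ++ ys) ls
  ls∉′ = All.zipWith
    (λ (l<z , z∉) z∈ →
       Sum.[ (λ z≡y → <-irrefl (sym z≡y) (≤-<-trans y≤l l<z)) , z∉ ]′ (∈-replace⁻ d z∈))
    (linked⇒All lk , ls∉)

moveBlock-preserves-Below : ∀ e {s r} ys → Unique (e ++ s ++ r ++ ys) →
  Linked _<_ s → Below r s →
  Below (moveBlock (e ++ moveBlock e s (r ++ ys)) r ys) (moveBlock e s (r ++ ys))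
moveBlock-preserves-Below e {s} {r} ys u lk below =
  moveBlock-below-vacated (e ++ s′) ys below lk (<-moveBlock e s (r ++ ys))
    (All.tabulate vacated)
  where
  s′ = moveBlock e s (r ++ ys)
  e#s++r++ys : Disjoint e (s ++ r ++ ys)
  e#s++r++ys = proj₂ (proj₂ (Unique-++⁻ e u))
  s#r++ys : Disjoint s (r ++ ys)
  s#r++ys = proj₂ (proj₂ (Unique-++⁻ s (proj₁ (proj₂ (Unique-++⁻ e u)))))
  vacated : ∀ {l} → l ∈ s → l ∉ (e ++ s′) ++ r ++ ys
  vacated l∈s l∈ with ∈-++⁻ (e ++ s′) l∈
  ... | inj₂ l∈r++ys = s#r++ys (l∈s , l∈r++ys)
  ... | inj₁ l∈e++s′ with ∈-++⁻ e l∈e++s′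
  ...   | inj₁ l∈e  = e#s++r++ys (l∈e , ∈-++⁺ˡ l∈s)
  ...   | inj₂ l∈s′ = All.lookup (moveBlock-vacates e (r ++ ys) lk) l∈s l∈s′

word-∷ : ∀ r T → word (r ∷ T) ≡ word T ++ r
word-∷ r T = begin
  concat (reverse (r ∷ T))    ≡⟨ cong concat (unfold-reverse r T) ⟩
  concat (reverse T ++ [ r ]) ≡⟨ concat-++ (reverse T) [ r ] ⟨
  word T ++ r ++ []           ≡⟨ cong (word T ++_) (++-identityʳ r) ⟩
  word T ++ r                 ∎

word-∷-++ : ∀ r T ys → word (r ∷ T) ++ ys ≡ word T ++ r ++ ys
word-∷-++ r T ys = trans (cong (_++ ys) (word-∷ r T)) (++-assoc (word T) r ys)

-- Rows are moved bottom row first, as they occur in the reading word; ys are the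
-- balls read after T.
moveRows : List (List ℤ) → List ℤ → List (List ℤ)
moveRows []      ys = []
moveRows (r ∷ T) ys = moveBlock (word T′) r ys ∷ T′
  where T′ = moveRows T (r ++ ys)

moveFrom-word : ∀ T ys → moveFrom [] (word T ++ ys) ≡ moveFrom (word (moveRows T ys)) ys
moveFrom-word []      ys = refl
moveFrom-word (r ∷ T) ys = begin
  moveFrom [] (word (r ∷ T) ++ ys) ≡⟨ cong (moveFrom []) (word-∷-++ r T ys) ⟩
  moveFrom [] (word T ++ r ++ ys)  ≡⟨ moveFrom-word T (r ++ ys) ⟩
  moveFrom (word T′) (r ++ ys)     ≡⟨ moveFrom-++ (word T′) r ys ⟩
  moveFrom (word T′ ++ r′) ys      ≡⟨ cong (λ d → moveFrom d ys) (word-∷ r′ T′) ⟨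
  moveFrom (word (r′ ∷ T′)) ys     ∎
  where
  T′ = moveRows T (r ++ ys)
  r′ = moveBlock (word T′) r ys

T*-word : ∀ T → T* (word T) ≡ word (moveRows T [])
T*-word T = begin
  moveFrom [] (word T)       ≡⟨ cong (moveFrom []) (++-identityʳ (word T)) ⟨
  moveFrom [] (word T ++ []) ≡⟨ moveFrom-word T [] ⟩
  word (moveRows T [])       ∎

shape-moveRows : ∀ T ys → shape (moveRows T ys) ≡ shape T
shape-moveRows []      ys = refl
shape-moveRows (r ∷ T) ys = cong₂ _∷_ (length-moveBlock _ r ys) (shape-moveRows T (r ++ ys))

Unique-moveRows : ∀ T ys → Unique (word T ++ ys) → Unique (word (moveRows T ys) ++ ys)
Unique-moveRows []      ys u = u
Unique-moveRows (r ∷ T) ys u =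
  subst Unique (sym (word-∷-++ (moveBlock (word T′) r ys) T′ ys))
    (Unique-moveBlock (word T′) r ys
      (Unique-moveRows T (r ++ ys) (subst Unique (word-∷-++ r T ys) u)))
  where T′ = moveRows T (r ++ ys)

rows-≤⇒< : ∀ T ys → Unique (word T ++ ys) → All (Linked _≤_) T → All (Linked _<_) T
rows-≤⇒< []      ys _ [] = []
rows-≤⇒< (r ∷ T) ys u (r≤ ∷ T≤) = linked-≤⇒< r-unique r≤ ∷ rows-≤⇒< T (r ++ ys) u′ T≤
  where
  u′ : Unique (word T ++ r ++ ys)
  u′ = subst Unique (word-∷-++ r T ys) u
  r-unique : Unique r
  r-unique = proj₁ (Unique-++⁻ r (proj₁ (proj₂ (Unique-++⁻ (word T) u′))))

moveRows-strict : ∀ T ys → All (Linked _<_) T → All (Linked _<_) (moveRows T ys)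
moveRows-strict []      ys []        = []
moveRows-strict (r ∷ T) ys (r< ∷ T<) = moveBlock-strict _ ys r< ∷ moveRows-strict T (r ++ ys) T<

moveRows-columns : ∀ T ys → Unique (word T ++ ys) → All (Linked _<_) T →
                   ColumnsStrict T → ColumnsStrict (moveRows T ys)
moveRows-columns []          ys _ _ _ = []
moveRows-columns (r ∷ [])    ys _ _ _ = [-]
moveRows-columns (r ∷ s ∷ T) ys u (_ ∷ s< ∷ T<) (r/s ∷ cols) =
  subst (λ d → Below (moveBlock d r ys) s′) (sym (word-∷ s′ T′))
    (moveBlock-preserves-Below (word T′) ys u″ s< r/s)
  ∷ moveRows-columns (s ∷ T) (r ++ ys) u′ (s< ∷ T<) cols
  where
  T′ = moveRows T (s ++ r ++ ys)
  s′ = moveBlock (word T′) s (r ++ ys)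
  u′ : Unique (word (s ∷ T) ++ r ++ ys)
  u′ = subst Unique (word-∷-++ r (s ∷ T) ys) u
  u″ : Unique (word T′ ++ s ++ r ++ ys)
  u″ = Unique-moveRows T (s ++ r ++ ys) (subst Unique (word-∷-++ s T (r ++ ys)) u′)

moveRows-tableau : ∀ T → Unique (word T) → IsTableau T → IsTableau (moveRows T [])
moveRows-tableau T u (rows , cols) =
  All.map (Linked.map <⇒≤) (moveRows-strict T [] strict) , moveRows-columns T [] u′ strict cols
  where
  u′ : Unique (word T ++ [])
  u′ = subst Unique (sym (++-identityʳ (word T))) u
  strict : All (Linked _<_) T
  strict = rows-≤⇒< T [] u′ rows

lemma4p2 : (λ′ : List ℕ) (b : List ℤ) → IsPartition λ′ → Unique b →
    IsTableauWord λ′ b → IsTableauWord λ′ (T* b)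
lemma4p2 _ _ _ unique (T , tableau , refl , refl) =
  moveRows T [] , moveRows-tableau T unique tableau , shape-moveRows T [] , sym (T*-word T)
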